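{- Let $G$ be a connected graph without cut-vertex that is not a clique and in which no vertex has a neighborhood that is a stable set. If $v$ is a simplicial vertex of $G$, then $G$ has a stable cutset if and only if $G-v$ has a stable cutset.
   Context: All graphs are finite and simple. A stable cutset of a graph $G$ is a set $S\subseteq V(G)$ whose vertices are pairwise non-adjacent and such that $G-S$ is disconnected (has at least two connected components); the empty set is a stable cutset of any disconnected graph. A cut-vertex is a vertex whose removal disconnects the graph. A vertex $v$ is simplicial if its neighborhood $N(v)$ is a clique. -}

module Defs where

open import Data.Nat using (ℕ)
open import Data.Fin using (Fin)
open import Data.Product using (Σ; ∃; ∃-syntax; _×_; _,_)
open import Data.Unit using (⊤)
open import Level using (0ℓ)
open import Relation.Nullary using (¬_; Dec)
open import Relation.Unary using (Pred; _⊆_; _∩_; ∁; U)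
open import Relation.Binary.PropositionalEquality using (_≡_; _≢_)

record Graph (n : ℕ) : Set₁ where
  field
    Adj    : Fin n → Fin n → Set
    adj?   : ∀ u v → Dec (Adj u v)
    sym    : ∀ {u v} → Adj u v → Adj v u
    irrefl : ∀ {u} → ¬ Adj u u

open Graph public

VSet : ℕ → Set₁
VSet n = Pred (Fin n) 0ℓ

module _ {n : ℕ} (G : Graph n) where

  Stable : VSet n → Set
  Stable S = ∀ {u v} → S u → S v → ¬ Adj G u v

  Clique : VSet n → Set
  Clique S = ∀ {u v} → S u → S v → u ≢ v → Adj G u v

  N : Fin n → VSet n
  N v = λ u → Adj G v u

  data Reach (W : VSet n) : Fin n → Fin n → Set where
    here : ∀ {u} → W u → Reach W u u
    step : ∀ {u w v} → W u → Adj G u w → Reach W w v → Reach W u v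

  ConnectedOn : VSet n → Set
  ConnectedOn W = ∀ {u v} → W u → W v → Reach W u v

  DisconnectedOn : VSet n → Set
  DisconnectedOn W = ∃[ u ] ∃[ v ] (W u × W v × ¬ Reach W u v)

  HasStableCutsetOn : VSet n → Set₁
  HasStableCutsetOn W = Σ (VSet n) λ S → (S ⊆ W) × Stable S × DisconnectedOn (W ∩ ∁ S)

  All : VSet n
  All = U

  minus : Fin n → VSet n
  minus v = λ x → x ≢ v

  Connected : Set
  Connected = ConnectedOn All

  IsCutVertex : Fin n → Set
  IsCutVertex x = DisconnectedOn (minus x)

  IsClique : Set
  IsClique = Clique All

  Simplicial : Fin n → Set
  Simplicial v = Clique (N v)

  HasStableCutset : Set₁
  HasStableCutset = HasStableCutsetOn All

  HasStableCutsetMinus : Fin n → Set₁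
  HasStableCutsetMinus v = HasStableCutsetOn (minus v)

{-# OPTIONS --safe #-}
module Submission where

-- Paths of G through the simplicial vertex v can be shortcut across the clique N(v), so a
-- stable cutset of G − v is also one of G. Conversely, if S is a stable cutset of G then
-- S − v is one of G − v: should v be one of the two separated vertices, replace it by a
-- neighbour outside S, which exists because N(v) is not stable.
--
-- That neighbour exists only up to double negation, since S is an arbitrary predicate.
-- Having a stable cutset on a decidable W is nevertheless ¬¬-stable: it is equivalent to
-- the decidable existence of a StableCutsetCertificate, whose cutset is a Subset and whose
-- separation is witnessed by a Subset closed under the edges of G[W] avoiding the cutset.

open import Defs
open import Data.Nat using (ℕ; zero; suc)
open import Data.Fin using (Fin; zero; suc; _≟_)
open import Data.Fin.Properties using (all?; any?)
open import Data.Fin.Subset using (Subset; _∈_; _∉_)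
open import Data.Fin.Subset.Properties using (_∈?_; anySubset?)
open import Data.Vec using (tabulate)
open import Data.Vec.Properties using (lookup∘tabulate; []=⇒lookup; lookup⇒[]=)
open import Data.Product using (Σ; ∃-syntax; _×_; _,_; proj₁; proj₂)
open import Data.Unit using (tt)
open import Data.Empty using (⊥-elim)
open import Function using (_∘_)
open import Effect.Monad using (RawMonad)
open import Relation.Unary using (Pred; Decidable; _⊆_; _≐_; _∩_; ∁)
open import Relation.Unary.Properties using (_∩?_; ∁?)
open import Relation.Nullary using (¬_; Dec; yes; no; does)
open import Relation.Nullary.Decidable using (map′; ¬?; _×-dec_; _→-dec_; dec-true; decidable-stable; ¬¬-excluded-middle)
open import Relation.Nullary.Negation using (¬¬-Monad; ¬¬-map)
open import Relation.Binary.PropositionalEquality using (_≢_; refl; trans) renaming (sym to ≡-sym)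

open module ¬¬ {a} = RawMonad (¬¬-Monad {a}) using (pure; _>>=_)

¬¬-decidable : ∀ {ℓ} {n} (P : Pred (Fin n) ℓ) → ¬ ¬ Decidable P
¬¬-decidable {n = zero}  P = pure λ ()
¬¬-decidable {n = suc n} P = do
  P₀? ← ¬¬-excluded-middle
  P₊? ← ¬¬-decidable (P ∘ suc)
  pure λ { zero → P₀? ; (suc x) → P₊? x }

module _ {ℓ} {n} {P : Pred (Fin n) ℓ} (P? : Decidable P) where

  toSubset : Subset n
  toSubset = tabulate (does ∘ P?)

  ∈-toSubset⁺ : ∀ {x} → P x → x ∈ toSubset
  ∈-toSubset⁺ {x} Px = lookup⇒[]= x _ (trans (lookup∘tabulate _ x) (dec-true (P? x) Px))

  ∈-toSubset⁻ : ∀ {x} → x ∈ toSubset → P x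
  ∈-toSubset⁻ {x} x∈ with P? x | trans (≡-sym (lookup∘tabulate (does ∘ P?) x)) ([]=⇒lookup x∈)
  ... | yes Px | _ = Px
  ... | no _   | ()

module _ {n : ℕ} (G : Graph n) where

  Reach-mono : ∀ {W W′ : VSet n} {x y} → W ⊆ W′ → Reach G W x y → Reach G W′ x y
  Reach-mono W⊆W′ (here Wx)       = here (W⊆W′ Wx)
  Reach-mono W⊆W′ (step Wx xz r) = step (W⊆W′ Wx) xz (Reach-mono W⊆W′ r)

  Reach-start : ∀ {W x y} → Reach G W x y → W x
  Reach-start (here Wx)      = Wx
  Reach-start (step Wx _ _) = Wx

  Reach-snoc : ∀ {W x y z} → Reach G W x y → W z → Adj G y z → Reach G W x z
  Reach-snoc (here Wy)       Wz yz = step Wy yz (here Wz)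
  Reach-snoc (step Wx xw r) Wz yz = step Wx xw (Reach-snoc r Wz yz)

  DisconnectedOn-resp-≐ : ∀ {W W′} → W ≐ W′ → DisconnectedOn G W → DisconnectedOn G W′
  DisconnectedOn-resp-≐ (W⊆W′ , W′⊆W) (u , w , Wu , Ww , u↛w) =
    u , w , W⊆W′ Wu , W⊆W′ Ww , u↛w ∘ Reach-mono W′⊆W

  Reach-bypass-simplicial : ∀ {v W x y} → Simplicial G v →
    Reach G W x y → x ≢ v → y ≢ v → Reach G (minus G v ∩ W) x y
  Reach-bypass-simplicial sv (here Wx) x≢v _ = here (x≢v , Wx)
  Reach-bypass-simplicial {v} sv (step {w = z} Wx xz r) x≢v y≢v with z ≟ v
  ... | no z≢v = step (x≢v , Wx) xz (Reach-bypass-simplicial sv r z≢v y≢v)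
  Reach-bypass-simplicial sv (step Wx xv (here _)) x≢v y≢v | yes refl = ⊥-elim (y≢v refl)
  Reach-bypass-simplicial {x = x} sv (step Wx xv (step {w = z′} _ vz′ r)) x≢v y≢v | yes refl
    with x ≟ z′
  ... | yes refl = Reach-bypass-simplicial sv r x≢v y≢v
  ... | no x≢z′ = step (x≢v , Wx) (sv (sym G xv) vz′ x≢z′)
                       (Reach-bypass-simplicial sv r (λ { refl → irrefl G vz′ }) y≢v)

  ≢-neighbour : ∀ {v a} → Adj G v a → a ≢ v
  ≢-neighbour va refl = irrefl G va

  ¬¬-neighbour-outside : ∀ {v S} → Stable G S → ¬ Stable G (N G v) →
    ¬ ¬ (∃[ a ] (Adj G v a × ¬ S a))
  ¬¬-neighbour-outside stab ¬stabN ∄a = ¬stabN λ {x} {y} vx vy xy →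
    ∄a (x , vx , λ Sx → ∄a (y , vy , λ Sy → stab Sx Sy xy))

  DisconnectedOn-minus : ∀ {v W} → DisconnectedOn G W →
    (W v → ¬ ¬ (∃[ a ] (Adj G v a × W a))) → ¬ ¬ DisconnectedOn G (minus G v ∩ W)
  DisconnectedOn-minus {v} (u , w , Wu , Ww , u↛w) nbr with u ≟ v | w ≟ v
  ... | no u≢v | no w≢v = pure (u , w , (u≢v , Wu) , (w≢v , Ww) , u↛w ∘ Reach-mono proj₂)
  ... | yes refl | yes refl = ⊥-elim (u↛w (here Wu))
  ... | yes refl | no w≢v = do
    a , va , Wa ← nbr Wu
    pure (a , w , (≢-neighbour va , Wa) , (w≢v , Ww) ,
          λ a→w → u↛w (step Wu va (Reach-mono proj₂ a→w)))
  ... | no u≢v | yes refl = do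
    a , va , Wa ← nbr Ww
    pure (u , a , (u≢v , Wu) , (≢-neighbour va , Wa) ,
          λ u→a → u↛w (Reach-snoc (Reach-mono proj₂ u→a) Ww (sym G va)))

  Closed : VSet n → Subset n → Set
  Closed W C = ∀ {x y} → x ∈ C → W y → Adj G x y → y ∈ C

  Closed-Reach : ∀ {W C x y} → Closed W C → Reach G W x y → x ∈ C → y ∈ C
  Closed-Reach cl (here _)      x∈C = x∈C
  Closed-Reach cl (step _ xz r) x∈C = Closed-Reach cl r (cl x∈C (Reach-start r) xz)

  Separator : VSet n → Set
  Separator W = Σ (Subset n) λ C → ∃[ u ] ∃[ w ] (W u × W w × u ∈ C × w ∉ C × Closed W C)

  Separator⇒DisconnectedOn : ∀ {W} → Separator W → DisconnectedOn G W
  Separator⇒DisconnectedOn (C , u , w , Wu , Ww , u∈C , w∉C , cl) =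
    u , w , Wu , Ww , λ u→w → w∉C (Closed-Reach cl u→w u∈C)

  DisconnectedOn⇒¬¬Separator : ∀ {W} → DisconnectedOn G W → ¬ ¬ Separator W
  DisconnectedOn⇒¬¬Separator {W} (u , w , Wu , Ww , u↛w) = do
    reach? ← ¬¬-decidable (Reach G W u)
    let reached⁺ = ∈-toSubset⁺ reach?
        reached⁻ = ∈-toSubset⁻ reach?
    pure (toSubset reach? , u , w , Wu , Ww , reached⁺ (here Wu) , u↛w ∘ reached⁻ ,
          λ {_} {_} x∈C Wy xy → reached⁺ (Reach-snoc (reached⁻ x∈C) Wy xy))

  all²? : {P : Fin n → Fin n → Set} → (∀ x y → Dec (P x y)) → Dec (∀ {x y} → P x y)
  all²? P? = map′ (λ ∀P {x} {y} → ∀P x y) (λ ∀P x y → ∀P) (all? λ x → all? (P? x))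

  separator? : ∀ {W} → Decidable W → Dec (Separator W)
  separator? W? = anySubset? λ C → any? λ u → any? λ w →
    W? u ×-dec W? w ×-dec u ∈? C ×-dec ¬? (w ∈? C) ×-dec
    all²? λ x y → x ∈? C →-dec W? y →-dec adj? G x y →-dec y ∈? C

  StableCutsetCertificate : VSet n → Set
  StableCutsetCertificate W =
    Σ (Subset n) λ T → (_∈ T) ⊆ W × Stable G (_∈ T) × Separator (W ∩ ∁ (_∈ T))

  stableCutsetCertificate? : ∀ {W} → Decidable W → Dec (StableCutsetCertificate W)
  stableCutsetCertificate? W? = anySubset? λ T →
    map′ (λ ∀P {x} → ∀P x) (λ ∀P x → ∀P) (all? λ x → x ∈? T →-dec W? x) ×-dec
    all²? (λ x y → x ∈? T →-dec y ∈? T →-dec ¬? (adj? G x y)) ×-dec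
    separator? (W? ∩? ∁? (_∈? T))

  StableCutsetCertificate⇒HasStableCutsetOn : ∀ {W} →
    StableCutsetCertificate W → HasStableCutsetOn G W
  StableCutsetCertificate⇒HasStableCutsetOn (T , T⊆W , stab , sep) =
    (_∈ T) , T⊆W , stab , Separator⇒DisconnectedOn sep

  HasStableCutsetOn⇒¬¬StableCutsetCertificate : ∀ {W} →
    HasStableCutsetOn G W → ¬ ¬ StableCutsetCertificate W
  HasStableCutsetOn⇒¬¬StableCutsetCertificate (S , S⊆W , stab , disc) = do
    S? ← ¬¬-decidable S
    let S⁺ = ∈-toSubset⁺ S?
        S⁻ = ∈-toSubset⁻ S?
        S≐T = (λ { {_} (Wx , ¬Sx) → Wx , ¬Sx ∘ S⁻ }) , (λ { {_} (Wx , x∉T) → Wx , x∉T ∘ S⁺ })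
    sep ← DisconnectedOn⇒¬¬Separator (DisconnectedOn-resp-≐ S≐T disc)
    pure (toSubset S? , (λ {_} → S⊆W ∘ S⁻) , (λ {_} {_} x∈T y∈T → stab (S⁻ x∈T) (S⁻ y∈T)) , sep)

  HasStableCutsetOn-stable : ∀ {W} → Decidable W → ¬ ¬ HasStableCutsetOn G W → HasStableCutsetOn G W
  HasStableCutsetOn-stable W? ¬¬cutset = StableCutsetCertificate⇒HasStableCutsetOn
    (decidable-stable (stableCutsetCertificate? W?) λ ¬cert →
      ¬¬cutset λ cutset → HasStableCutsetOn⇒¬¬StableCutsetCertificate cutset ¬cert)

  HasStableCutset⇒HasStableCutsetMinus : ∀ {v} → ¬ Stable G (N G v) →
    HasStableCutset G → HasStableCutsetMinus G v
  HasStableCutset⇒HasStableCutsetMinus {v} ¬stabN (S , _ , stab , disc) =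
    HasStableCutsetOn-stable (∁? (_≟ v))
      (¬¬-map cutsetMinus (DisconnectedOn-minus disc neighbour))
    where
    neighbour : (All G ∩ ∁ S) v → ¬ ¬ (∃[ a ] (Adj G v a × (All G ∩ ∁ S) a))
    neighbour _ = ¬¬-map (λ (a , va , ¬Sa) → a , va , tt , ¬Sa) (¬¬-neighbour-outside stab ¬stabN)

    S−v : VSet n
    S−v = S ∩ minus G v

    cutsetMinus : DisconnectedOn G (minus G v ∩ (All G ∩ ∁ S)) → HasStableCutsetMinus G v
    cutsetMinus disc′ = S−v , proj₂ , (λ (Sx , _) (Sy , _) → stab Sx Sy) ,
      DisconnectedOn-resp-≐
        ( (λ (x≢v , _ , ¬Sx) → x≢v , ¬Sx ∘ proj₁)
        , (λ (x≢v , ¬S−vx) → x≢v , tt , λ Sx → ¬S−vx (Sx , x≢v)))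
        disc′

  HasStableCutsetMinus⇒HasStableCutset : ∀ {v} → Simplicial G v →
    HasStableCutsetMinus G v → HasStableCutset G
  HasStableCutsetMinus⇒HasStableCutset sv
    (S , _ , stab , u , w , (u≢v , ¬Su) , (w≢v , ¬Sw) , u↛w) =
    S , (λ _ → tt) , stab , u , w , (tt , ¬Su) , (tt , ¬Sw) ,
    λ u→w → u↛w (Reach-mono (λ (x≢v , _ , ¬Sx) → x≢v , ¬Sx)
                              (Reach-bypass-simplicial sv u→w u≢v w≢v))

lemma4 : ∀ {n : ℕ} (G : Graph n) →
    Connected G →
    (∀ x → ¬ IsCutVertex G x) →
    ¬ IsClique G →
    (∀ x → ¬ Stable G (N G x)) →
    (v : Fin n) → Simplicial G v →
    (HasStableCutset G → HasStableCutsetMinus G v) × (HasStableCutsetMinus G v → HasStableCutset G)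
lemma4 G _ _ _ ¬stableN v sv =
  HasStableCutset⇒HasStableCutsetMinus G (¬stableN v) , HasStableCutsetMinus⇒HasStableCutset G sv
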